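{- For every positive integer $n$, the polytope $\mathrm{BTP}(n)\subseteq\mathbb{R}^{\binom{n}{2}}$ has dimension $\binom{n}{2}$.
   Context: A TSSCPP boolean triangle of order $n$ is a triangular array $(b_{i,n-j})_{1\le j\le i\le n-1}$ (so $\binom{n}{2}$ entries, row $i$ consisting of $b_{i,n-i},\dots,b_{i,n-1}$) with entries in $\{0,1\}$ such that for all $1\le j<i\le n-1$, $$1+\sum_{k=j+1}^{i}b_{k,n-j-1}\ge\sum_{k=j}^{i}b_{k,n-j}.$$ $\mathrm{BTP}(n)$ is the convex hull in $\mathbb{R}^{\binom{n}{2}}$ (coordinates indexed by the positions $(i,n-j)$, $1\le j\le i\le n-1$) of all TSSCPP boolean triangles of order $n$.
   Formalization: Points have rational coordinates and affine combinations of TSSCPP boolean triangles use rational coefficients, instead of real coordinates and coefficients in ℝ. -}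

module Defs where

open import Data.Nat using (ℕ; zero; suc; _+_; _∸_; _≤_; _<_; _≤?_; _<?_)
open import Data.Bool using (Bool; true; false; if_then_else_)
open import Data.List using (List; []; _∷_; map; upTo)
open import Data.Nat.ListAction using (sum)
open import Data.List.Relation.Unary.All using (All)
open import Data.Product using (_×_; _,_; proj₁; proj₂; ∃)
open import Data.Rational using (ℚ; 0ℚ; 1ℚ) renaming (_+_ to _+ℚ_; _*_ to _*ℚ_)
open import Relation.Nullary using (yes; no)
open import Relation.Binary.PropositionalEquality using (_≡_)

-- A position (i, n-j) of the triangle, stored via the pair (i , j)
-- with 1 ≤ j ≤ i ≤ n-1 (i.e. i < n).  These are the binom(n,2) coordinates.
record Pos (n : ℕ) : Set where
  constructor pos
  field
    i   : ℕ
    j   : ℕ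
    1≤j : 1 ≤ j
    j≤i : j ≤ i
    i<n : i < n

Triangle : ℕ → Set
Triangle n = Pos n → Bool

-- entry T k j = b_{k, n-j} as a natural number (0 outside the triangle,
-- never used there).
entry : {n : ℕ} → Triangle n → ℕ → ℕ → ℕ
entry {n} T k j with 1 ≤? j | j ≤? k | k <? n
... | yes a | yes b | yes c = if T (pos k j a b c) then 1 else 0
... | _     | _     | _     = 0

sumFromTo : (ℕ → ℕ) → ℕ → ℕ → ℕ
sumFromTo f a b = sum (map (λ t → f (a + t)) (upTo (suc b ∸ a)))

-- TSSCPP boolean triangle condition: for all 1 ≤ j < i ≤ n-1,
--   1 + Σ_{k=j+1}^{i} b_{k,n-j-1} ≥ Σ_{k=j}^{i} b_{k,n-j}.
IsTSSCPP : (n : ℕ) → Triangle n → Set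
IsTSSCPP n T = ∀ i j → 1 ≤ j → j < i → i ≤ n ∸ 1 →
  sumFromTo (λ k → entry T k j) j i
    ≤ 1 + sumFromTo (λ k → entry T k (suc j)) (suc j) i

Point : ℕ → Set
Point n = Pos n → ℚ

toℚ : Bool → ℚ
toℚ true  = 1ℚ
toℚ false = 0ℚ

coeffSum : {n : ℕ} → List (ℚ × Triangle n) → ℚ
coeffSum []             = 0ℚ
coeffSum ((c , _) ∷ cs) = c +ℚ coeffSum cs

combo : {n : ℕ} → List (ℚ × Triangle n) → Point n
combo []             p = 0ℚ
combo ((c , T) ∷ cs) p = (c *ℚ toℚ (T p)) +ℚ combo cs p

-- v lies in the affine hull of the TSSCPP boolean triangles of order n
-- (= affine hull of BTP(n)).
InAffineHullBTP : (n : ℕ) → Point n → Set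
InAffineHullBTP n v = ∃ λ (L : List (ℚ × Triangle n)) →
  All (λ cT → IsTSSCPP n (proj₂ cT)) L × coeffSum L ≡ 1ℚ × (∀ p → combo L p ≡ v p)

-- dim BTP(n) = binom(n,2) (the ambient dimension): the affine hull of BTP(n)
-- is the whole coordinate space.
BTPFullDimensional : ℕ → Set
BTPFullDimensional n = ∀ (v : Point n) → InAffineHullBTP n v

{-# OPTIONS --safe #-}
-- The zero triangle and every triangle with a single 1 are TSSCPP boolean
-- triangles: each column of theirs contains at most one 1, so the left-hand
-- side of every defining inequality is at most 1.  The unit triangles span
-- the coordinate space linearly, and adding the zero triangle with
-- coefficient 1 minus the sum of the other coefficients turns a linear
-- combination into an affine one without moving the point.
module Submission where

open import Defs
open import Data.Nat using (ℕ; _≤_; zero; suc; _+_; _∸_; _<_; z≤n; s≤s; _≟_; _≤?_; _<?_)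
open import Data.Nat.Properties
  using (≤-refl; ≤-trans; ≤-reflexive; ≤-irrelevant; +-identityʳ; +-monoʳ-≤; m≤m+n; m+n∸m≡n; suc-injective; ≤-<-trans)
open import Data.Bool using (true; false; _∧_; if_then_else_)
open import Data.List using (List; []; _∷_; [_]; _++_; concat; applyUpTo)
open import Data.List.Properties using (map-upTo)
open import Data.Nat.ListAction using (sum)
open import Data.List.Relation.Unary.All using (All; []; _∷_)
open import Data.List.Relation.Unary.All.Properties using (concat⁺; applyUpTo⁺₂)
open import Data.Product using (_×_; _,_; proj₂; ∃)
open import Data.Rational using (ℚ; 0ℚ; 1ℚ; _-_; -_) renaming (_+_ to _+ℚ_; _*_ to _*ℚ_)
open import Data.Rational.Properties using (+-assoc; +-inverseˡ; +-identityˡ; *-zeroʳ; *-identityʳ)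
  renaming (+-identityʳ to +ℚ-identityʳ)
open import Function using (_∘_)
open import Relation.Nullary using (yes; no; does)
open import Relation.Nullary.Decidable using (dec-true; dec-false; dec-yes-irr)
open import Relation.Binary.PropositionalEquality
  using (_≡_; _≢_; refl; sym; trans; cong; cong₂; module ≡-Reasoning)

open ≡-Reasoning

sum-applyUpTo-≤-support : ∀ (g : ℕ → ℕ) c m → (∀ t → t ≢ c → g t ≡ 0) →
                          sum (applyUpTo g m) ≤ g c
sum-applyUpTo-≤-support g c zero _ = z≤n
sum-applyUpTo-≤-support g zero (suc m) vanish =
  ≤-trans (+-monoʳ-≤ (g 0) rest≤0) (≤-reflexive (+-identityʳ (g 0)))
  where
  rest≤0 : sum (applyUpTo (g ∘ suc) m) ≤ 0
  rest≤0 = ≤-trans (sum-applyUpTo-≤-support (g ∘ suc) 0 m (λ t _ → vanish (suc t) λ ()))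
                   (≤-reflexive (vanish 1 λ ()))
sum-applyUpTo-≤-support g (suc c) (suc m) vanish
  rewrite vanish 0 (λ ())
  = sum-applyUpTo-≤-support (g ∘ suc) c m (λ t t≢c → vanish (suc t) (t≢c ∘ suc-injective))

-- If c < a, then f vanishes on the whole range and the bound f a is 0.
sumFromTo-≤-support : ∀ (f : ℕ → ℕ) c a b → (∀ k → k ≢ c → f k ≡ 0) →
                      sumFromTo f a b ≤ f (a + (c ∸ a))
sumFromTo-≤-support f c a b vanish
  rewrite map-upTo (λ t → f (a + t)) (suc b ∸ a)
  = sum-applyUpTo-≤-support (λ t → f (a + t)) (c ∸ a) (suc b ∸ a)
      (λ t t≢c∸a → vanish (a + t) λ a+t≡c →
        t≢c∸a (trans (sym (m+n∸m≡n a t)) (cong (_∸ a) a+t≡c)))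

module _ {n : ℕ} where

  entry≤1 : (T : Triangle n) → ∀ k j → entry T k j ≤ 1
  entry≤1 T k j with 1 ≤? j | j ≤? k | k <? n
  ... | yes 1≤j | yes j≤k | yes k<n = indicator≤1 (T (pos k j 1≤j j≤k k<n))
    where
    indicator≤1 : ∀ b → (if b then 1 else 0) ≤ 1
    indicator≤1 true  = ≤-refl
    indicator≤1 false = z≤n
  ... | no _  | _     | _     = z≤n
  ... | yes _ | no _  | _     = z≤n
  ... | yes _ | yes _ | no _  = z≤n

  entry-≡0 : (T : Triangle n) → ∀ k j →
             (∀ q → Pos.i q ≡ k → Pos.j q ≡ j → T q ≡ false) → entry T k j ≡ 0
  entry-≡0 T k j off with 1 ≤? j | j ≤? k | k <? n
  ... | yes 1≤j | yes j≤k | yes k<n rewrite off (pos k j 1≤j j≤k k<n) refl refl = refl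
  ... | no _  | _     | _     = refl
  ... | yes _ | no _  | _     = refl
  ... | yes _ | yes _ | no _  = refl

  ColumnSparse : Triangle n → Set
  ColumnSparse T = ∀ j → ∃ λ c → ∀ k → k ≢ c → entry T k j ≡ 0

  columnSparse⇒IsTSSCPP : (T : Triangle n) → ColumnSparse T → IsTSSCPP n T
  columnSparse⇒IsTSSCPP T sparse i j _ _ _ with sparse j
  ... | c , vanish = ≤-trans (sumFromTo-≤-support (λ k → entry T k j) c j i vanish)
                             (≤-trans (entry≤1 T (j + (c ∸ j)) j) (m≤m+n 1 _))

  zeroTriangle : Triangle n
  zeroTriangle _ = false

  unitTriangle : ℕ → ℕ → Triangle n
  unitTriangle a b q = does (Pos.i q ≟ a) ∧ does (Pos.j q ≟ b)

  unitTriangle-offRow : ∀ a b q → Pos.i q ≢ a → unitTriangle a b q ≡ false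
  unitTriangle-offRow a b q i≢a rewrite dec-false (Pos.i q ≟ a) i≢a = refl

  unitTriangle-offColumn : ∀ a b q → Pos.j q ≢ b → unitTriangle a b q ≡ false
  unitTriangle-offColumn a b q j≢b
    rewrite dec-false (Pos.j q ≟ b) j≢b with does (Pos.i q ≟ a)
  ... | true  = refl
  ... | false = refl

  unitTriangle-at : ∀ q → unitTriangle (Pos.i q) (Pos.j q) q ≡ true
  unitTriangle-at q rewrite dec-true (Pos.i q ≟ Pos.i q) refl | dec-true (Pos.j q ≟ Pos.j q) refl = refl

  zeroTriangle-IsTSSCPP : IsTSSCPP n zeroTriangle
  zeroTriangle-IsTSSCPP = columnSparse⇒IsTSSCPP zeroTriangle
    (λ j → 0 , λ k _ → entry-≡0 zeroTriangle k j (λ _ _ _ → refl))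

  unitTriangle-IsTSSCPP : ∀ a b → IsTSSCPP n (unitTriangle a b)
  unitTriangle-IsTSSCPP a b = columnSparse⇒IsTSSCPP (unitTriangle a b)
    (λ j → a , λ k k≢a → entry-≡0 (unitTriangle a b) k j
      (λ q i≡k _ → unitTriangle-offRow a b q (k≢a ∘ trans (sym i≡k))))

  Combination : Set
  Combination = List (ℚ × Triangle n)

  AllTSSCPP : Combination → Set
  AllTSSCPP = All (λ cT → IsTSSCPP n (proj₂ cT))

  combo-∷-false : ∀ c (T : Triangle n) L p → T p ≡ false → combo ((c , T) ∷ L) p ≡ combo L p
  combo-∷-false c T L p Tp≡false rewrite Tp≡false = begin
    c *ℚ 0ℚ +ℚ combo L p  ≡⟨ cong (_+ℚ combo L p) (*-zeroʳ c) ⟩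
    0ℚ +ℚ combo L p       ≡⟨ +-identityˡ (combo L p) ⟩
    combo L p             ∎

  combo-[-]-true : ∀ c (T : Triangle n) p → T p ≡ true → combo [ (c , T) ] p ≡ c
  combo-[-]-true c T p Tp≡true rewrite Tp≡true = trans (+ℚ-identityʳ (c *ℚ 1ℚ)) (*-identityʳ c)

  combo-++ : ∀ (L M : Combination) p → combo (L ++ M) p ≡ combo L p +ℚ combo M p
  combo-++ []            M p = sym (+-identityˡ (combo M p))
  combo-++ ((c , T) ∷ L) M p = begin
    c *ℚ toℚ (T p) +ℚ combo (L ++ M) p              ≡⟨ cong (c *ℚ toℚ (T p) +ℚ_) (combo-++ L M p) ⟩
    c *ℚ toℚ (T p) +ℚ (combo L p +ℚ combo M p)      ≡⟨ sym (+-assoc (c *ℚ toℚ (T p)) (combo L p) (combo M p)) ⟩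
    c *ℚ toℚ (T p) +ℚ combo L p +ℚ combo M p        ∎

  combo-concat-≡0 : ∀ (B : ℕ → Combination) m p → (∀ t → combo (B t) p ≡ 0ℚ) →
                    combo (concat (applyUpTo B m)) p ≡ 0ℚ
  combo-concat-≡0 B zero    p vanish = refl
  combo-concat-≡0 B (suc m) p vanish = begin
    combo (B 0 ++ concat (applyUpTo (B ∘ suc) m)) p                ≡⟨ combo-++ (B 0) (concat (applyUpTo (B ∘ suc) m)) p ⟩
    combo (B 0) p +ℚ combo (concat (applyUpTo (B ∘ suc) m)) p      ≡⟨ cong₂ _+ℚ_ (vanish 0) (combo-concat-≡0 (B ∘ suc) m p (vanish ∘ suc)) ⟩
    0ℚ +ℚ 0ℚ                                                       ≡⟨ +-identityˡ 0ℚ ⟩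
    0ℚ                                                             ∎

  combo-concat-support : ∀ (B : ℕ → Combination) c m p → c < m →
                         (∀ t → t ≢ c → combo (B t) p ≡ 0ℚ) →
                         combo (concat (applyUpTo B m)) p ≡ combo (B c) p
  combo-concat-support B zero (suc m) p _ vanish = begin
    combo (B 0 ++ concat (applyUpTo (B ∘ suc) m)) p                ≡⟨ combo-++ (B 0) (concat (applyUpTo (B ∘ suc) m)) p ⟩
    combo (B 0) p +ℚ combo (concat (applyUpTo (B ∘ suc) m)) p      ≡⟨ cong (combo (B 0) p +ℚ_) (combo-concat-≡0 (B ∘ suc) m p (λ t → vanish (suc t) λ ())) ⟩
    combo (B 0) p +ℚ 0ℚ                                            ≡⟨ +ℚ-identityʳ (combo (B 0) p) ⟩
    combo (B 0) p                                                  ∎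
  combo-concat-support B (suc c) (suc m) p (s≤s c<m) vanish = begin
    combo (B 0 ++ concat (applyUpTo (B ∘ suc) m)) p                ≡⟨ combo-++ (B 0) (concat (applyUpTo (B ∘ suc) m)) p ⟩
    combo (B 0) p +ℚ combo (concat (applyUpTo (B ∘ suc) m)) p      ≡⟨ cong (_+ℚ combo (concat (applyUpTo (B ∘ suc) m)) p) (vanish 0 λ ()) ⟩
    0ℚ +ℚ combo (concat (applyUpTo (B ∘ suc) m)) p                 ≡⟨ +-identityˡ (combo (concat (applyUpTo (B ∘ suc) m)) p) ⟩
    combo (concat (applyUpTo (B ∘ suc) m)) p                       ≡⟨ combo-concat-support (B ∘ suc) c m p c<m (λ t t≢c → vanish (suc t) (t≢c ∘ suc-injective)) ⟩
    combo (B (suc c)) p                                            ∎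

  span⊆affineHull : (v : Point n) (L : Combination) → AllTSSCPP L →
                    (∀ p → combo L p ≡ v p) → InAffineHullBTP n v
  span⊆affineHull v L L-TSSCPP L≡v =
    (1ℚ - S , zeroTriangle) ∷ L , zeroTriangle-IsTSSCPP ∷ L-TSSCPP , coeffSum≡1 ,
    λ p → trans (combo-∷-false (1ℚ - S) zeroTriangle L p refl) (L≡v p)
    where
    S : ℚ
    S = coeffSum L

    coeffSum≡1 : 1ℚ - S +ℚ S ≡ 1ℚ
    coeffSum≡1 = begin
      1ℚ +ℚ - S +ℚ S    ≡⟨ +-assoc 1ℚ (- S) S ⟩
      1ℚ +ℚ (- S +ℚ S)  ≡⟨ cong (1ℚ +ℚ_) (+-inverseˡ S) ⟩
      1ℚ +ℚ 0ℚ          ≡⟨ +ℚ-identityʳ 1ℚ ⟩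
      1ℚ                ∎

  coord : Point n → ℕ → ℕ → ℚ
  coord v a b with 1 ≤? b | b ≤? a | a <? n
  ... | yes 1≤b | yes b≤a | yes a<n = v (pos a b 1≤b b≤a a<n)
  ... | _       | _       | _       = 0ℚ

  coord-pos : ∀ v p → coord v (Pos.i p) (Pos.j p) ≡ v p
  coord-pos v (pos i j 1≤j j≤i i<n)
    rewrite dec-yes-irr (1 ≤? j) ≤-irrelevant 1≤j
          | dec-yes-irr (j ≤? i) ≤-irrelevant j≤i
          | dec-yes-irr (i <? n) ≤-irrelevant i<n = refl

  rowExpansion : Point n → ℕ → Combination
  rowExpansion v a = concat (applyUpTo (λ b → [ (coord v a b , unitTriangle a b) ]) n)

  unitExpansion : Point n → Combination
  unitExpansion v = concat (applyUpTo (rowExpansion v) n)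

  unitExpansion-AllTSSCPP : ∀ v → AllTSSCPP (unitExpansion v)
  unitExpansion-AllTSSCPP v = concat⁺ (applyUpTo⁺₂ (rowExpansion v) n λ a →
    concat⁺ (applyUpTo⁺₂ _ n λ b → unitTriangle-IsTSSCPP a b ∷ []))

  combo-rowExpansion-offRow : ∀ v a p → Pos.i p ≢ a → combo (rowExpansion v a) p ≡ 0ℚ
  combo-rowExpansion-offRow v a p i≢a = combo-concat-≡0 _ n p λ b →
    combo-∷-false (coord v a b) (unitTriangle a b) [] p (unitTriangle-offRow a b p i≢a)

  combo-rowExpansion-onRow : ∀ v p → combo (rowExpansion v (Pos.i p)) p ≡ coord v (Pos.i p) (Pos.j p)
  combo-rowExpansion-onRow v p = trans
    (combo-concat-support _ (Pos.j p) n p j<n λ b b≢j →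
      combo-∷-false (coord v (Pos.i p) b) (unitTriangle (Pos.i p) b) [] p
        (unitTriangle-offColumn (Pos.i p) b p (b≢j ∘ sym)))
    (combo-[-]-true (coord v (Pos.i p) (Pos.j p)) (unitTriangle (Pos.i p) (Pos.j p)) p (unitTriangle-at p))
    where
    j<n : Pos.j p < n
    j<n = ≤-<-trans (Pos.j≤i p) (Pos.i<n p)

  combo-unitExpansion : ∀ v p → combo (unitExpansion v) p ≡ v p
  combo-unitExpansion v p = begin
    combo (unitExpansion v) p              ≡⟨ combo-concat-support (rowExpansion v) (Pos.i p) n p (Pos.i<n p)
                                                (λ a a≢i → combo-rowExpansion-offRow v a p (a≢i ∘ sym)) ⟩
    combo (rowExpansion v (Pos.i p)) p     ≡⟨ combo-rowExpansion-onRow v p ⟩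
    coord v (Pos.i p) (Pos.j p)            ≡⟨ coord-pos v p ⟩
    v p                                    ∎

proposition5p2 : (n : ℕ) → 1 ≤ n → BTPFullDimensional n
proposition5p2 n _ v = span⊆affineHull v (unitExpansion v) (unitExpansion-AllTSSCPP v) (combo-unitExpansion v)
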